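{- Let $P$ be a descending convex polyomino (as defined in the context). Then $P$ is \textsf{Z}-convex if and only if both of the following hold: (i) every cell of the region $\theta$ of $P$ has ordinate greater than or equal to the smallest ordinate of a cell of the column $S$ of $P$; and (ii) the reduction $\Phi(P)$ is \textsf{Z}-convex.
   Context: Cells are unit squares of $\mathbb Z\times\mathbb Z$, a cell being identified with its integer coordinates (abscissa, ordinate). A polyomino is a finite connected union of cells with no cut point; it is convex if each of its rows and each of its columns (intersections with horizontal/vertical strips of cells) is connected. A path in a polyomino is a self-avoiding sequence of its cells, consecutive cells being adjacent (steps $N,S,E,W$); it is monotone if it uses steps of at most two types; a change of direction is a pair of consecutive distinct steps. A convex polyomino is \textsf{Z}-convex if any two of its cells are joined by a monotone path with at most two changes of direction. A convex polyomino is centered if some row of it touches both the left and right sides of its minimal bounding rectangle. For a convex polyomino $P$, let $a$ be the abscissa of its leftmost column $c_1$, let $x_{\mathrm{top}}$ and $y_{\mathrm{bot}}$ be the largest and smallest ordinates of cells of $c_1$; row $X$ is the row of ordinate $x_{\mathrm{top}}$ and row $Y$ the row of ordinate $y_{\mathrm{bot}}$. $P$ is descending if it is not centered and its rightmost column lies entirely strictly below row $Y$. For descending $P$, let $s$ and $t$ be the abscissas of the rightmost cells of rows $X$ and $Y$ respectively; column $S$ is the set of cells of $P$ of abscissa $s$ and ordinate $\le x_{\mathrm{top}}$, column $T$ the set of cells of abscissa $t$ and ordinate $\le y_{\mathrm{bot}}$. Define regions: $\omega$ = cells of $P$ with ordinate $>x_{\mathrm{top}}$; $\theta$ = cells of $P$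 with abscissa $>t$; $\xi$ = cells of $P$ with ordinate $\le y_{\mathrm{bot}}$ and abscissa $\le s$ (this contains the hook $H$ formed by the part of row $Y$ of abscissa $\le s$ together with the cells of column $S$ of ordinate $\le y_{\mathrm{bot}}$); $\Lambda$ = all remaining cells of $P$. The reduction $\Phi(P)$ is the polyomino obtained by deleting $\Lambda$, translating $\omega$ by $(0,-(x_{\mathrm{top}}-y_{\mathrm{bot}}))$ (so $\omega$ is glued on top of $\xi$ keeping abscissas), and translating $\theta$ by $(-(t-s),0)$ (so $\theta$ is glued to the right of $\omega\cup\xi$ keeping ordinates relative to $\xi$); the hook $H$ is kept in $\Phi(P)$. -}

module Defs where

open import Data.Nat using (ℕ; zero; suc; _≤_)
import Data.Nat as ℕ
open import Data.Integer as ℤ using (ℤ; _+_; _-_; -_; _⊓_; _⊔_; _<_; _≤?_; _<?_; _≟_)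
open import Data.Product using (Σ; ∃; ∃-syntax; _×_; _,_; proj₁; proj₂)
open import Data.Sum using (_⊎_)
open import Data.List using (List; []; _∷_; _++_; map; filter; foldr; length)
open import Data.List.Membership.Propositional using (_∈_)
open import Data.List.Relation.Unary.All using (All)
open import Data.List.Relation.Unary.Unique.Propositional using (Unique)
open import Relation.Binary.PropositionalEquality using (_≡_)
open import Relation.Nullary using (¬_)
open import Relation.Nullary.Decidable using (_×-dec_)
open import Data.Bool using (Bool; true; false; if_then_else_)

-- A cell is identified with its integer coordinates (abscissa, ordinate).
Cell : Set
Cell = ℤ × ℤ

-- A (finite) set of cells, represented by a list (read as a set: only
-- membership matters).
Cells : Set
Cells = List Cell

translate : ℤ → ℤ → Cell → Cell
translate dx dy (x , y) = (x + dx , y + dy)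

data Dir : Set where
  N S E W : Dir

move : Dir → Cell → Cell
move N (x , y) = (x , y + ℤ.1ℤ)
move S (x , y) = (x , y - ℤ.1ℤ)
move E (x , y) = (x + ℤ.1ℤ , y)
move W (x , y) = (x - ℤ.1ℤ , y)

cellsOf : Cell → List Dir → List Cell
cellsOf c []       = c ∷ []
cellsOf c (d ∷ ds) = c ∷ cellsOf (move d c) ds

endOf : Cell → List Dir → Cell
endOf c []       = c
endOf c (d ∷ ds) = endOf (move d c) ds

Walk : Cells → Cell → Cell → List Dir → Set
Walk P c d ds = All (_∈ P) (cellsOf c ds) × endOf c ds ≡ d

Path : Cells → Cell → Cell → List Dir → Set
Path P c d ds = Walk P c d ds × Unique (cellsOf c ds)

Monotone : List Dir → Set
Monotone ds = ∃[ d₁ ] ∃[ d₂ ] All (λ d → d ≡ d₁ ⊎ d ≡ d₂) ds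

sameDir : Dir → Dir → Bool
sameDir N N = true
sameDir S S = true
sameDir E E = true
sameDir W W = true
sameDir _ _ = false

changes : List Dir → ℕ
changes (d ∷ d' ∷ ds) = (if sameDir d d' then 0 else 1) ℕ.+ changes (d' ∷ ds)
changes _             = 0

-- finite (list), nonempty, connected union of cells (edge-connectedness,
-- which for unions of cells is connectedness without cut points)
Polyomino : Cells → Set
Polyomino P = (∃[ c ] c ∈ P) ×
              (∀ c d → c ∈ P → d ∈ P → ∃[ ds ] Walk P c d ds)

RowsConvex : Cells → Set
RowsConvex P = ∀ x₁ x₂ x y → (x₁ , y) ∈ P → (x₂ , y) ∈ P →
               x₁ ℤ.≤ x → x ℤ.≤ x₂ → (x , y) ∈ P

ColumnsConvex : Cells → Set
ColumnsConvex P = ∀ x y₁ y₂ y → (x , y₁) ∈ P → (x , y₂) ∈ P →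
                  y₁ ℤ.≤ y → y ℤ.≤ y₂ → (x , y) ∈ P

ConvexPolyomino : Cells → Set
ConvexPolyomino P = Polyomino P × RowsConvex P × ColumnsConvex P

ZConvex : Cells → Set
ZConvex P = ConvexPolyomino P ×
  (∀ c d → c ∈ P → d ∈ P →
     ∃[ ds ] (Path P c d ds × Monotone ds × changes ds ≤ 2))

-- Minimum / maximum of a list of integers (value 0 on the empty list,
-- never used on empty lists below)

minL : List ℤ → ℤ
minL []       = ℤ.0ℤ
minL (x ∷ xs) = foldr _⊓_ x xs

maxL : List ℤ → ℤ
maxL []       = ℤ.0ℤ
maxL (x ∷ xs) = foldr _⊔_ x xs

leftX : Cells → ℤ
leftX P = minL (map proj₁ P)

rightX : Cells → ℤ
rightX P = maxL (map proj₁ P)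

column₁ : Cells → Cells
column₁ P = filter (λ c → proj₁ c ≟ leftX P) P

xtop : Cells → ℤ
xtop P = maxL (map proj₂ (column₁ P))

ybot : Cells → ℤ
ybot P = minL (map proj₂ (column₁ P))

rowAt : ℤ → Cells → Cells
rowAt y P = filter (λ c → proj₂ c ≟ y) P

Centered : Cells → Set
Centered P = ∃[ y ] ((leftX P , y) ∈ P × (rightX P , y) ∈ P)

Descending : Cells → Set
Descending P = ¬ Centered P ×
  (∀ c → c ∈ P → proj₁ c ≡ rightX P → proj₂ c < ybot P)

sX : Cells → ℤ
sX P = maxL (map proj₁ (rowAt (xtop P) P))

tY : Cells → ℤ
tY P = maxL (map proj₁ (rowAt (ybot P) P))

columnS : Cells → Cells
columnS P = filter (λ c → (proj₁ c ≟ sX P) ×-dec (proj₂ c ≤? xtop P)) P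

columnT : Cells → Cells
columnT P = filter (λ c → (proj₁ c ≟ tY P) ×-dec (proj₂ c ≤? ybot P)) P

ω : Cells → Cells
ω P = filter (λ c → xtop P <? proj₂ c) P

θ : Cells → Cells
θ P = filter (λ c → tY P <? proj₁ c) P

ξ : Cells → Cells
ξ P = filter (λ c → (proj₂ c ≤? ybot P) ×-dec (proj₁ c ≤? sX P)) P

Φ : Cells → Cells
Φ P = ξ P
   ++ map (translate ℤ.0ℤ (- (xtop P - ybot P))) (ω P)
   ++ map (translate (- (tY P - sX P)) ℤ.0ℤ) (θ P)

{-# OPTIONS --safe #-}
-- In a convex polyomino, a monotone path with at most two changes of
-- direction joins c to e iff some column of the polyomino meets the rows of c
-- and e, or some row meets their columns: such a walk consists of three
-- straight runs, and conversely convexity lets one slide the middle run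
-- between c and e, while the sum of the coordinates along the two directions
-- used strictly increases, so the path is self-avoiding. Z-convexity is thus
-- a statement about rows and columns only.
--
-- For descending P, a walk from the rightmost column, which lies below row Y,
-- shows that no cell at or above row Y (resp. X) lies right of t (resp. s).
-- Hence θ lies below row Y and ω left of s, Φ(P) is convex, and rows and
-- columns linking two cells are carried between P and Φ(P) region by region.
-- Condition (i) says that column S meets every row of θ. It is necessary
-- because a cell of θ is linked to the top cell (a , x_top) of the first
-- column only through a column left of s; and it supplies the links through
-- column S that the translation of θ would otherwise break.
module Submission where

open import Defs
open import Data.Integer using (_≤_)
open import Data.Product using (_×_; proj₂)
open import Data.List using (map)
open import Data.List.Membership.Propositional using (_∈_)
open import Function.Bundles using (_⇔_)

open import Algebra.Definitions using (Selective)
open import Data.Bool using (true; false; if_then_else_)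
open import Data.Empty using (⊥-elim)
open import Data.Integer as ℤ using (ℤ; +_; _+_; _-_; -_; _<_; 0ℤ; 1ℤ; ∣_∣)
import Data.Integer.Properties as ℤP
open import Data.Integer.Tactic.RingSolver using (solve-∀)
open import Data.List using ([]; _∷_; _++_; replicate; foldr)
open import Data.List.Properties using (foldr-preservesᵇ; foldr-preservesᵒ)
open import Data.List.Membership.Propositional.Properties
  using (∈-map⁺; ∈-map⁻; ∈-filter⁺; ∈-filter⁻; ∈-++⁺ˡ; ∈-++⁺ʳ; ∈-++⁻)
open import Data.List.Relation.Unary.All as All using (All; []; _∷_)
import Data.List.Relation.Unary.All.Properties as AllP
open import Data.List.Relation.Unary.AllPairs using ([]; _∷_)
open import Data.List.Relation.Unary.Any as Any using (here; there)
open import Data.List.Relation.Unary.Unique.Propositional using (Unique)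
open import Data.Nat as ℕ using (ℕ; zero; suc; s≤s; z≤n)
import Data.Nat.Properties as ℕP
open import Data.Product using (∃-syntax; _,_; proj₁)
open import Data.Sum using (_⊎_; inj₁; inj₂; [_,_])
open import Function.Bundles using (mk⇔)
open import Relation.Binary.PropositionalEquality
  using (_≡_; refl; sym; trans; cong; cong₂; subst; module ≡-Reasoning)
open import Relation.Nullary using (yes; no)
open import Relation.Nullary.Decidable using (_×-dec_)

i<i+1 : ∀ i → i < i + 1ℤ
i<i+1 i = ℤP.suc[i]≤j⇒i<j (ℤP.≤-reflexive (ℤP.+-comm 1ℤ i))

i<j⇒i+1≤j : ∀ {i j} → i < j → i + 1ℤ ≤ j
i<j⇒i+1≤j {i} {j} i<j = subst (_≤ j) (ℤP.+-comm 1ℤ i) (ℤP.i<j⇒suc[i]≤j i<j)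

i-j+j≡i : ∀ i j → i - j + j ≡ i
i-j+j≡i = solve-∀

i+j-j≡i : ∀ i j → i + j - j ≡ i
i+j-j≡i = solve-∀

i-1<i : ∀ i → i - 1ℤ < i
i-1<i i = subst (i - 1ℤ <_) (i-j+j≡i i 1ℤ) (i<i+1 (i - 1ℤ))

i-1<j⇒i≤j : ∀ {i j} → i - 1ℤ < j → i ≤ j
i-1<j⇒i≤j {i} {j} i-1<j = subst (_≤ j) (i-j+j≡i i 1ℤ) (i<j⇒i+1≤j i-1<j)

0≤j⇒i≤i+j : ∀ {i j} → 0ℤ ≤ j → i ≤ i + j
0≤j⇒i≤i+j {i} 0≤j = subst (_≤ i + _) (ℤP.+-identityʳ i) (ℤP.+-monoʳ-≤ i 0≤j)

i+[j-i]≡j : ∀ i j → i + (j - i) ≡ j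
i+[j-i]≡j = solve-∀

j-[j-i]≡i : ∀ i j → j - (j - i) ≡ i
j-[j-i]≡i = solve-∀

i<x⇒j<x+[j-i] : ∀ {i j x} → i < x → j < x + (j - i)
i<x⇒j<x+[j-i] {i} {j} {x} i<x =
  subst (_< x + (j - i)) (i+[j-i]≡j i j) (ℤP.+-monoˡ-< (j - i) i<x)

j<x⇒i<x-[j-i] : ∀ {i j x} → j < x → i < x - (j - i)
j<x⇒i<x-[j-i] {i} {j} {x} j<x =
  subst (_< x - (j - i)) (j-[j-i]≡i i j) (ℤP.+-monoˡ-< (- (j - i)) j<x)

-- Z-convexity in terms of rows and columns

data Axis : Set where
  horizontal vertical : Axis

other : Axis → Axis
other horizontal = vertical
other vertical   = horizontal

axis : Dir → Axis
axis N = vertical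
axis S = vertical
axis E = horizontal
axis W = horizontal

Aligned : Axis → Cell → Cell → Set
Aligned horizontal (_ , y₁) (_ , y₂) = y₁ ≡ y₂
Aligned vertical   (x₁ , _) (x₂ , _) = x₁ ≡ x₂

aligned-refl : ∀ α {c} → Aligned α c c
aligned-refl horizontal = refl
aligned-refl vertical   = refl

aligned-sym : ∀ α {c d} → Aligned α c d → Aligned α d c
aligned-sym horizontal = sym
aligned-sym vertical   = sym

aligned-trans : ∀ α {c d e} → Aligned α c d → Aligned α d e → Aligned α c e
aligned-trans horizontal = trans
aligned-trans vertical   = trans

aligned-move : ∀ d c → Aligned (axis d) c (move d c)
aligned-move N _ = refl
aligned-move S _ = refl
aligned-move E _ = refl
aligned-move W _ = refl

cellsOf-head : ∀ {P : Cell → Set} c ds → All P (cellsOf c ds) → P c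
cellsOf-head c []      (pc ∷ _) = pc
cellsOf-head c (_ ∷ _) (pc ∷ _) = pc

cellsOf-last : ∀ {P : Cell → Set} c ds → All P (cellsOf c ds) → P (endOf c ds)
cellsOf-last c []       (pc ∷ _) = pc
cellsOf-last c (d ∷ ds) (_ ∷ ps) = cellsOf-last (move d c) ds ps

sameDir-sound : ∀ d d' → sameDir d d' ≡ true → d ≡ d'
sameDir-sound N N _ = refl
sameDir-sound S S _ = refl
sameDir-sound E E _ = refl
sameDir-sound W W _ = refl
sameDir-sound N S ()
sameDir-sound N E ()
sameDir-sound N W ()
sameDir-sound S N ()
sameDir-sound S E ()
sameDir-sound S W ()
sameDir-sound E N ()
sameDir-sound E S ()
sameDir-sound E W ()
sameDir-sound W N ()
sameDir-sound W S ()
sameDir-sound W E ()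

-- Segments may be empty, so k bounds the number of turns rather than fixing it.
data ZigZag (Q : Cells) : ℕ → Axis → Cell → Cell → Set where
  segment : ∀ {α c e} → Aligned α c e → ZigZag Q zero α c e
  corner  : ∀ {k α c p e} → p ∈ Q → Aligned α c p → ZigZag Q k (other α) p e →
            ZigZag Q (suc k) α c e

zigzag-straight : ∀ {Q} k {α c e} → e ∈ Q → Aligned α c e → ZigZag Q k α c e
zigzag-straight zero    eQ c~e = segment c~e
zigzag-straight (suc k) eQ c~e = corner eQ c~e (zigzag-straight k eQ (aligned-refl _))

zigzag-extend : ∀ {Q k α c c' e} → Aligned α c c' → ZigZag Q k α c' e → ZigZag Q k α c e
zigzag-extend {α = α} c~c' (segment c'~e)     = segment (aligned-trans α c~c' c'~e)
zigzag-extend {α = α} c~c' (corner pQ c'~p z) = corner pQ (aligned-trans α c~c' c'~p) z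

zigzag-suc : ∀ {Q k α c e} → e ∈ Q → ZigZag Q k α c e → ZigZag Q (suc k) α c e
zigzag-suc eQ (segment c~e)     = zigzag-straight 1 eQ c~e
zigzag-suc eQ (corner pQ c~p z) = corner pQ c~p (zigzag-suc eQ z)

zigzag-turn : ∀ {Q k} α β {c p e} → e ∈ Q → p ∈ Q →
              Aligned α c p → ZigZag Q k β p e → ZigZag Q (suc k) α c e
zigzag-turn horizontal horizontal eQ pQ c~p z = zigzag-suc eQ (zigzag-extend c~p z)
zigzag-turn horizontal vertical   eQ pQ c~p z = corner pQ c~p z
zigzag-turn vertical   horizontal eQ pQ c~p z = corner pQ c~p z
zigzag-turn vertical   vertical   eQ pQ c~p z = zigzag-suc eQ (zigzag-extend c~p z)

walk-zigzag : ∀ {Q} k d c ds → All (_∈ Q) (cellsOf c (d ∷ ds)) → changes (d ∷ ds) ℕ.≤ k →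
              ZigZag Q k (axis d) c (endOf c (d ∷ ds))
walk-zigzag k d c [] (_ ∷ eQ ∷ []) _ = zigzag-straight k eQ (aligned-move d c)
walk-zigzag k d c (d' ∷ ds) (_ ∷ cells) turns with sameDir d d' in same
... | true with sameDir-sound d d' same
...   | refl = zigzag-extend (aligned-move d c) (walk-zigzag k d (move d c) ds cells turns)
walk-zigzag (suc k) d c (d' ∷ ds) (_ ∷ cells) (s≤s turns) | false =
  zigzag-turn (axis d) (axis d') (cellsOf-last (move d c) (d' ∷ ds) cells)
    (cellsOf-head (move d c) (d' ∷ ds) cells) (aligned-move d c)
    (walk-zigzag k d' (move d c) ds cells turns)

ZLinked : Cells → Cell → Cell → Set
ZLinked Q (x₁ , y₁) (x₂ , y₂) =
  (∃[ u ] (u , y₁) ∈ Q × (u , y₂) ∈ Q) ⊎ (∃[ v ] (x₁ , v) ∈ Q × (x₂ , v) ∈ Q)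

AllZLinked : Cells → Set
AllZLinked Q = ∀ {c e} → c ∈ Q → e ∈ Q → ZLinked Q c e

zlinked-sym : ∀ {Q} c e → ZLinked Q c e → ZLinked Q e c
zlinked-sym _ _ (inj₁ (u , p , q)) = inj₁ (u , q , p)
zlinked-sym _ _ (inj₂ (v , p , q)) = inj₂ (v , q , p)

zigzag-linked : ∀ {Q} α {c e} → ZigZag Q 2 α c e → ZLinked Q c e
zigzag-linked horizontal (corner pQ refl (corner qQ refl (segment refl))) = inj₁ (_ , pQ , qQ)
zigzag-linked vertical   (corner pQ refl (corner qQ refl (segment refl))) = inj₂ (_ , pQ , qQ)

ZConvex⇒linked : ∀ {Q} → ZConvex Q → AllZLinked Q
ZConvex⇒linked (_ , zpaths) {c} {e} cQ eQ with zpaths c e cQ eQ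
... | []     , ((_     , refl) , _) , _         = inj₁ (_ , cQ , cQ)
... | d ∷ ds , ((cells , refl) , _) , _ , turns =
  zigzag-linked (axis d) (walk-zigzag 2 d c ds cells turns)

coord : Dir → Cell → ℤ
coord N (_ , y) = y
coord S (_ , y) = - y
coord E (x , _) = x
coord W (x , _) = - x

coord-move : ∀ d c → coord d (move d c) ≡ coord d c + 1ℤ
coord-move N _       = refl
coord-move S (_ , y) = ℤP.neg-distrib-+ y (- 1ℤ)
coord-move E _       = refl
coord-move W (x , _) = ℤP.neg-distrib-+ x (- 1ℤ)

coord-other : ∀ d {c e} → Aligned (other (axis d)) c e → coord d c ≡ coord d e
coord-other N refl = refl
coord-other S refl = refl
coord-other E refl = refl
coord-other W refl = refl

coord-injective : ∀ d {c e} → Aligned (axis d) c e → coord d c ≡ coord d e → c ≡ e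
coord-injective N refl refl = refl
coord-injective S refl eq   = cong (_ ,_) (ℤP.neg-injective eq)
coord-injective E refl refl = refl
coord-injective W refl eq   = cong (_, _) (ℤP.neg-injective eq)

Ahead : Dir → Cell → Cell → Set
Ahead d c e = Aligned (axis d) c e × coord d c ≤ coord d e

ahead-trans : ∀ d {c p e} → Ahead d c p → Ahead d p e → Ahead d c e
ahead-trans d (c~p , c≤p) (p~e , p≤e) = aligned-trans (axis d) c~p p~e , ℤP.≤-trans c≤p p≤e

ahead-move : ∀ d c → Ahead d c (move d c)
ahead-move d c =
  aligned-move d c , ℤP.≤-trans (ℤP.<⇒≤ (i<i+1 _)) (ℤP.≤-reflexive (sym (coord-move d c)))

ahead-∈ : ∀ {Q} → RowsConvex Q → ColumnsConvex Q → ∀ d {c p e} →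
          Ahead d c p → Ahead d p e → c ∈ Q → e ∈ Q → p ∈ Q
ahead-∈ rc cc N {x , y₁} {_ , y} {_ , y₂} (refl , l₁) (refl , l₂) cQ eQ = cc x y₁ y₂ y cQ eQ l₁ l₂
ahead-∈ rc cc S {x , y₁} {_ , y} {_ , y₂} (refl , l₁) (refl , l₂) cQ eQ =
  cc x y₂ y₁ y eQ cQ (ℤP.neg-cancel-≤ l₂) (ℤP.neg-cancel-≤ l₁)
ahead-∈ rc cc E {x₁ , y} {x , _} {x₂ , _} (refl , l₁) (refl , l₂) cQ eQ = rc x₁ x₂ x y cQ eQ l₁ l₂
ahead-∈ rc cc W {x₁ , y} {x , _} {x₂ , _} (refl , l₁) (refl , l₂) cQ eQ =
  rc x₂ x₁ x y eQ cQ (ℤP.neg-cancel-≤ l₂) (ℤP.neg-cancel-≤ l₁)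

run-ahead : ∀ d n c → Ahead d c (endOf c (replicate n d))
run-ahead d zero    c = aligned-refl (axis d) , ℤP.≤-refl
run-ahead d (suc n) c = ahead-trans d (ahead-move d c) (run-ahead d n (move d c))

run-end : ∀ d n {c e} → Aligned (axis d) c e → coord d e ≡ coord d c + + n →
          endOf c (replicate n d) ≡ e
run-end d zero    {c} c~e eq = coord-injective d c~e (sym (trans eq (ℤP.+-identityʳ (coord d c))))
run-end d (suc n) {c} {e} c~e eq =
  run-end d n (aligned-trans (axis d) (aligned-sym (axis d) (aligned-move d c)) c~e) (begin
    coord d e                     ≡⟨ eq ⟩
    coord d c + + suc n           ≡⟨ ℤP.+-assoc (coord d c) 1ℤ (+ n) ⟨
    coord d c + 1ℤ + + n          ≡⟨ cong (_+ + n) (coord-move d c) ⟨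
    coord d (move d c) + + n      ∎)
  where open ≡-Reasoning

ahead⇒run : ∀ d {c e} → Ahead d c e → ∃[ n ] endOf c (replicate n d) ≡ e
ahead⇒run d {c} {e} (c~e , c≤e) = ∣ coord d e - coord d c ∣ , run-end d _ c~e (begin
  coord d e
    ≡⟨ i+[j-i]≡j (coord d c) (coord d e) ⟨
  coord d c + (coord d e - coord d c)
    ≡⟨ cong (λ i → coord d c + i) (ℤP.0≤i⇒+∣i∣≡i (ℤP.i≤j⇒0≤j-i c≤e)) ⟨
  coord d c + + ∣ coord d e - coord d c ∣ ∎)
  where open ≡-Reasoning

run-∈ : ∀ {Q} → RowsConvex Q → ColumnsConvex Q → ∀ d n c →
        c ∈ Q → endOf c (replicate n d) ∈ Q → All (_∈ Q) (cellsOf c (replicate n d))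
run-∈ rc cc d zero    c cQ _  = cQ ∷ []
run-∈ rc cc d (suc n) c cQ eQ =
  cQ ∷ run-∈ rc cc d n (move d c)
         (ahead-∈ rc cc d (ahead-move d c) (run-ahead d n (move d c)) cQ eQ) eQ

Increasing : (Cell → ℤ) → Dir → Set
Increasing f d = ∀ c → f c < f (move d c)

increasing-≤ : ∀ f c ds → All (Increasing f) ds → All (λ e → f c ≤ f e) (cellsOf c ds)
increasing-≤ f c []       _            = ℤP.≤-refl ∷ []
increasing-≤ f c (d ∷ ds) (inc ∷ incs) =
  ℤP.≤-refl ∷ All.map (ℤP.≤-trans (ℤP.<⇒≤ (inc c))) (increasing-≤ f (move d c) ds incs)

increasing⇒unique : ∀ f c ds → All (Increasing f) ds → Unique (cellsOf c ds)
increasing⇒unique f c []       _            = [] ∷ []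
increasing⇒unique f c (d ∷ ds) (inc ∷ incs) =
  All.map (λ c'≤e c≡e → ℤP.<⇒≱ (inc c) (subst (λ e → f (move d c) ≤ f e) (sym c≡e) c'≤e))
          (increasing-≤ f (move d c) ds incs)
  ∷ increasing⇒unique f (move d c) ds incs

other-involutive : ∀ α → other (other α) ≡ α
other-involutive horizontal = refl
other-involutive vertical   = refl

coord-move-across : ∀ d d' c → axis d ≡ other (axis d') → coord d' (move d c) ≡ coord d' c
coord-move-across d d' c d⊥d' =
  sym (coord-other d' (subst (λ α → Aligned α c (move d c)) d⊥d' (aligned-move d c)))

sameDir-refl : ∀ d → sameDir d d ≡ true
sameDir-refl N = refl
sameDir-refl S = refl
sameDir-refl E = refl
sameDir-refl W = refl

changes-replicate : ∀ n d → changes (replicate n d) ≡ 0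
changes-replicate zero          d = refl
changes-replicate (suc zero)    d = refl
changes-replicate (suc (suc n)) d =
  trans (cong (λ same → (if same then 0 else 1) ℕ.+ changes (d ∷ replicate n d)) (sameDir-refl d))
        (changes-replicate (suc n) d)

changes-∷ : ∀ d ds → changes (d ∷ ds) ℕ.≤ suc (changes ds)
changes-∷ d []        = z≤n
changes-∷ d (d' ∷ ds) with sameDir d d'
... | true  = ℕP.n≤1+n _
... | false = ℕP.≤-refl

changes-++ : ∀ ds ds' → changes (ds ++ ds') ℕ.≤ changes ds ℕ.+ suc (changes ds')
changes-++ []            ds' = ℕP.n≤1+n _
changes-++ (d ∷ [])      ds' = changes-∷ d ds'
changes-++ (d ∷ d' ∷ ds) ds' =
  ℕP.≤-trans (ℕP.+-monoʳ-≤ turn (changes-++ (d' ∷ ds) ds'))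
             (ℕP.≤-reflexive (sym (ℕP.+-assoc turn _ _)))
  where turn = if sameDir d d' then 0 else 1

endOf-++ : ∀ c ds ds' → endOf c (ds ++ ds') ≡ endOf (endOf c ds) ds'
endOf-++ c []       ds' = refl
endOf-++ c (d ∷ ds) ds' = endOf-++ (move d c) ds ds'

cellsOf-++ : ∀ {P : Cell → Set} c ds ds' →
             All P (cellsOf c ds) → All P (cellsOf (endOf c ds) ds') → All P (cellsOf c (ds ++ ds'))
cellsOf-++ c []       ds' _        ps' = ps'
cellsOf-++ c (d ∷ ds) ds' (pc ∷ ps) ps' = pc ∷ cellsOf-++ (move d c) ds ds' ps ps'

ZPath : Cells → Cell → Cell → Set
ZPath Q c e = ∃[ ds ] Path Q c e ds × Monotone ds × changes ds ℕ.≤ 2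

three-run-path : ∀ {Q} → RowsConvex Q → ColumnsConvex Q → ∀ d₁ d₂ → axis d₂ ≡ other (axis d₁) →
                 ∀ {c p q e} → c ∈ Q → p ∈ Q → q ∈ Q → e ∈ Q →
                 Ahead d₁ c p → Ahead d₂ p q → Ahead d₁ q e → ZPath Q c e
three-run-path rc cc d₁ d₂ d₂⊥d₁ {c} cQ pQ qQ eQ c→p p→q q→e
  with ahead⇒run d₁ c→p | ahead⇒run d₂ p→q | ahead⇒run d₁ q→e
... | n₁ , refl | n₂ , refl | n₃ , refl =
  run₁ ++ run₂ ++ run₃ , ((cells , ends) , increasing⇒unique potential c _ increases) ,
  (d₁ , d₂ , directions) , turns
  where
  run₁ = replicate n₁ d₁
  run₂ = replicate n₂ d₂
  run₃ = replicate n₃ d₁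
  p = endOf c run₁
  q = endOf p run₂

  cells : All (_∈ _) (cellsOf c (run₁ ++ run₂ ++ run₃))
  cells = cellsOf-++ c run₁ (run₂ ++ run₃) (run-∈ rc cc d₁ n₁ c cQ pQ)
            (cellsOf-++ p run₂ run₃ (run-∈ rc cc d₂ n₂ p pQ qQ) (run-∈ rc cc d₁ n₃ q qQ eQ))

  ends : endOf c (run₁ ++ run₂ ++ run₃) ≡ endOf q run₃
  ends = trans (endOf-++ c run₁ (run₂ ++ run₃)) (endOf-++ p run₂ run₃)

  directions : All (λ d → d ≡ d₁ ⊎ d ≡ d₂) (run₁ ++ run₂ ++ run₃)
  directions = AllP.++⁺ (AllP.replicate⁺ n₁ (inj₁ refl))
                 (AllP.++⁺ (AllP.replicate⁺ n₂ (inj₂ refl)) (AllP.replicate⁺ n₃ (inj₁ refl)))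

  potential : Cell → ℤ
  potential c = coord d₁ c + coord d₂ c

  increases₁ : Increasing potential d₁
  increases₁ c rewrite coord-move d₁ c | coord-move-across d₁ d₂ c
                         (trans (sym (other-involutive (axis d₁))) (cong other (sym d₂⊥d₁))) =
    ℤP.+-monoˡ-< (coord d₂ c) (i<i+1 (coord d₁ c))

  increases₂ : Increasing potential d₂
  increases₂ c rewrite coord-move d₂ c | coord-move-across d₂ d₁ c d₂⊥d₁ =
    ℤP.+-monoʳ-< (coord d₁ c) (i<i+1 (coord d₂ c))

  increases : All (Increasing potential) (run₁ ++ run₂ ++ run₃)
  increases = AllP.++⁺ (AllP.replicate⁺ n₁ increases₁)
                (AllP.++⁺ (AllP.replicate⁺ n₂ increases₂) (AllP.replicate⁺ n₃ increases₁))

  turns : changes (run₁ ++ run₂ ++ run₃) ℕ.≤ 2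
  turns = begin
    changes (run₁ ++ run₂ ++ run₃)
      ≤⟨ changes-++ run₁ (run₂ ++ run₃) ⟩
    changes run₁ ℕ.+ suc (changes (run₂ ++ run₃))
      ≤⟨ ℕP.+-monoʳ-≤ (changes run₁) (s≤s (changes-++ run₂ run₃)) ⟩
    changes run₁ ℕ.+ suc (changes run₂ ℕ.+ suc (changes run₃))
      ≡⟨ cong₂ (λ a b → a ℕ.+ suc b) (changes-replicate n₁ d₁)
           (cong₂ (λ b c → b ℕ.+ suc c) (changes-replicate n₂ d₂) (changes-replicate n₃ d₁)) ⟩
    2 ∎
    where open ℕP.≤-Reasoning

column-between : ∀ {Q} → RowsConvex Q → ∀ {x₁ x₂ y₁ y₂ u} → x₁ ≤ x₂ →
                 (x₁ , y₁) ∈ Q → (x₂ , y₂) ∈ Q → (u , y₁) ∈ Q → (u , y₂) ∈ Q →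
                 ∃[ u' ] x₁ ≤ u' × u' ≤ x₂ × (u' , y₁) ∈ Q × (u' , y₂) ∈ Q
column-between rc {x₁} {x₂} {y₁} {y₂} {u} x₁≤x₂ c e p q with ℤP.≤-total u x₁ | ℤP.≤-total u x₂
... | inj₁ u≤x₁ | _         = x₁ , ℤP.≤-refl , x₁≤x₂ , c , rc u x₂ x₁ y₂ q e u≤x₁ x₁≤x₂
... | inj₂ x₁≤u | inj₁ u≤x₂ = u , x₁≤u , u≤x₂ , p , q
... | inj₂ x₁≤u | inj₂ x₂≤u = x₂ , x₁≤x₂ , ℤP.≤-refl , rc x₁ u x₂ y₁ c p x₁≤x₂ x₂≤u , e

row-between : ∀ {Q} → ColumnsConvex Q → ∀ {x₁ x₂ y₁ y₂ v} → y₁ ≤ y₂ →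
              (x₁ , y₁) ∈ Q → (x₂ , y₂) ∈ Q → (x₁ , v) ∈ Q → (x₂ , v) ∈ Q →
              ∃[ v' ] y₁ ≤ v' × v' ≤ y₂ × (x₁ , v') ∈ Q × (x₂ , v') ∈ Q
row-between cc {x₁} {x₂} {y₁} {y₂} {v} y₁≤y₂ c e p q with ℤP.≤-total v y₁ | ℤP.≤-total v y₂
... | inj₁ v≤y₁ | _         = y₁ , ℤP.≤-refl , y₁≤y₂ , c , cc x₂ v y₂ y₁ q e v≤y₁ y₁≤y₂
... | inj₂ y₁≤v | inj₁ v≤y₂ = v , y₁≤v , v≤y₂ , p , q
... | inj₂ y₁≤v | inj₂ y₂≤v = y₂ , y₁≤y₂ , ℤP.≤-refl , cc x₁ y₁ v y₂ c p y₁≤y₂ y₂≤v , e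

towards-horizontally : ∀ x₁ x₂ y → ∃[ h ] axis h ≡ horizontal × Ahead h (x₁ , y) (x₂ , y)
towards-horizontally x₁ x₂ y with ℤP.≤-total x₁ x₂
... | inj₁ x₁≤x₂ = E , refl , refl , x₁≤x₂
... | inj₂ x₂≤x₁ = W , refl , refl , ℤP.neg-mono-≤ x₂≤x₁

towards-vertically : ∀ x y₁ y₂ → ∃[ v ] axis v ≡ vertical × Ahead v (x , y₁) (x , y₂)
towards-vertically x y₁ y₂ with ℤP.≤-total y₁ y₂
... | inj₁ y₁≤y₂ = N , refl , refl , y₁≤y₂
... | inj₂ y₂≤y₁ = S , refl , refl , ℤP.neg-mono-≤ y₂≤y₁

linked⇒zpath : ∀ {Q} → RowsConvex Q → ColumnsConvex Q →
               ∀ {c e} → c ∈ Q → e ∈ Q → ZLinked Q c e → ZPath Q c e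
linked⇒zpath rc cc {x₁ , y₁} {x₂ , y₂} cQ eQ (inj₁ (u , p , q)) with ℤP.≤-total x₁ x₂
... | inj₁ x₁≤x₂ =
  let u' , x₁≤u' , u'≤x₂ , p' , q' = column-between rc x₁≤x₂ cQ eQ p q
      v , vertical-v , p'→q' = towards-vertically u' y₁ y₂
  in three-run-path rc cc E v vertical-v cQ p' q' eQ (refl , x₁≤u') p'→q' (refl , u'≤x₂)
... | inj₂ x₂≤x₁ =
  let u' , x₂≤u' , u'≤x₁ , q' , p' = column-between rc x₂≤x₁ eQ cQ q p
      v , vertical-v , p'→q' = towards-vertically u' y₁ y₂
  in three-run-path rc cc W v vertical-v cQ p' q' eQ
       (refl , ℤP.neg-mono-≤ u'≤x₁) p'→q' (refl , ℤP.neg-mono-≤ x₂≤u')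
linked⇒zpath rc cc {x₁ , y₁} {x₂ , y₂} cQ eQ (inj₂ (v , p , q)) with ℤP.≤-total y₁ y₂
... | inj₁ y₁≤y₂ =
  let v' , y₁≤v' , v'≤y₂ , p' , q' = row-between cc y₁≤y₂ cQ eQ p q
      h , horizontal-h , p'→q' = towards-horizontally x₁ x₂ v'
  in three-run-path rc cc N h horizontal-h cQ p' q' eQ (refl , y₁≤v') p'→q' (refl , v'≤y₂)
... | inj₂ y₂≤y₁ =
  let v' , y₂≤v' , v'≤y₁ , q' , p' = row-between cc y₂≤y₁ eQ cQ q p
      h , horizontal-h , p'→q' = towards-horizontally x₁ x₂ v'
  in three-run-path rc cc S h horizontal-h cQ p' q' eQ
       (refl , ℤP.neg-mono-≤ v'≤y₁) p'→q' (refl , ℤP.neg-mono-≤ y₂≤v')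

linked⇒ZConvex : ∀ {Q} → (∃[ c ] c ∈ Q) → RowsConvex Q → ColumnsConvex Q → AllZLinked Q → ZConvex Q
linked⇒ZConvex {Q} nonempty rc cc linked = ((nonempty , walk) , rc , cc) , zpath
  where
  zpath : ∀ c e → c ∈ Q → e ∈ Q → ZPath Q c e
  zpath c e cQ eQ = linked⇒zpath rc cc cQ eQ (linked cQ eQ)

  walk : ∀ c e → c ∈ Q → e ∈ Q → ∃[ ds ] Walk Q c e ds
  walk c e cQ eQ = let ds , (w , _) , _ = zpath c e cQ eQ in ds , w

foldr-∈ : ∀ {A : Set} {_•_ : A → A → A} → Selective _≡_ _•_ → ∀ x xs → foldr _•_ x xs ∈ x ∷ xs
foldr-∈ selective x xs =
  foldr-preservesᵇ (λ {a} {b} a∈ b∈ → [ (λ eq → subst (_∈ x ∷ xs) (sym eq) a∈)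
                                      , (λ eq → subst (_∈ x ∷ xs) (sym eq) b∈) ] (selective a b))
                   (here refl) (All.tabulate there)

minL-∈ : ∀ {xs z} → z ∈ xs → minL xs ∈ xs
minL-∈ {x ∷ xs} _ = foldr-∈ ℤP.⊓-sel x xs

maxL-∈ : ∀ {xs z} → z ∈ xs → maxL xs ∈ xs
maxL-∈ {x ∷ xs} _ = foldr-∈ ℤP.⊔-sel x xs

minL-≤ : ∀ {xs z} → z ∈ xs → minL xs ≤ z
minL-≤ {x ∷ xs} {z} z∈ = foldr-preservesᵒ
  (λ a b → [ ℤP.≤-trans (ℤP.i⊓j≤i a b) , ℤP.≤-trans (ℤP.i⊓j≤j a b) ]) x xs (at-most z∈)
  where
  at-most : ∀ {x xs} → z ∈ x ∷ xs → x ≤ z ⊎ Any.Any (_≤ z) xs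
  at-most (here refl) = inj₁ ℤP.≤-refl
  at-most (there z∈)  = inj₂ (Any.map (λ z≡y → ℤP.≤-reflexive (sym z≡y)) z∈)

≤-maxL : ∀ {xs z} → z ∈ xs → z ≤ maxL xs
≤-maxL {x ∷ xs} {z} z∈ = foldr-preservesᵒ
  (λ a b → [ (λ z≤a → ℤP.≤-trans z≤a (ℤP.i≤i⊔j a b)) , (λ z≤b → ℤP.≤-trans z≤b (ℤP.i≤j⊔i a b)) ])
  x xs (at-least z∈)
  where
  at-least : ∀ {x xs} → z ∈ x ∷ xs → z ≤ x ⊎ Any.Any (z ≤_) xs
  at-least (here refl) = inj₁ ℤP.≤-refl
  at-least (there z∈)  = inj₂ (Any.map ℤP.≤-reflexive z∈)

abscissa-∈ : ∀ {Q : Cells} {x} → x ∈ map proj₁ Q → ∃[ y ] (x , y) ∈ Q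
abscissa-∈ x∈ with ∈-map⁻ proj₁ x∈
... | _ , c∈ , refl = _ , c∈

ordinate-∈ : ∀ {Q : Cells} {y} → y ∈ map proj₂ Q → ∃[ x ] (x , y) ∈ Q
ordinate-∈ y∈ with ∈-map⁻ proj₂ y∈
... | _ , c∈ , refl = _ , c∈

module _ {P : Cells} where

  leftX-≤ : ∀ {x y} → (x , y) ∈ P → leftX P ≤ x
  leftX-≤ c∈ = minL-≤ (∈-map⁺ proj₁ c∈)

  ≤-rightX : ∀ {x y} → (x , y) ∈ P → x ≤ rightX P
  ≤-rightX c∈ = ≤-maxL (∈-map⁺ proj₁ c∈)

  leftX-∈ : ∀ {c} → c ∈ P → ∃[ y ] (leftX P , y) ∈ P
  leftX-∈ c∈ = abscissa-∈ (minL-∈ (∈-map⁺ proj₁ c∈))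

  rightX-∈ : ∀ {c} → c ∈ P → ∃[ y ] (rightX P , y) ∈ P
  rightX-∈ c∈ = abscissa-∈ (maxL-∈ (∈-map⁺ proj₁ c∈))

  ∈-column₁ : ∀ {y} → (leftX P , y) ∈ P → (leftX P , y) ∈ column₁ P
  ∈-column₁ c∈ = ∈-filter⁺ (λ c → proj₁ c ℤ.≟ leftX P) c∈ refl

  column₁-∈ : ∀ {x y} → (x , y) ∈ column₁ P → (leftX P , y) ∈ P
  column₁-∈ c∈ with ∈-filter⁻ (λ c → proj₁ c ℤ.≟ leftX P) {xs = P} c∈
  ... | c∈P , refl = c∈P

  ybot-≤ : ∀ {y} → (leftX P , y) ∈ P → ybot P ≤ y
  ybot-≤ c∈ = minL-≤ (∈-map⁺ proj₂ (∈-column₁ c∈))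

  ybot-∈ : ∀ {y} → (leftX P , y) ∈ P → (leftX P , ybot P) ∈ P
  ybot-∈ c∈ = column₁-∈ (proj₂ (ordinate-∈ (minL-∈ (∈-map⁺ proj₂ (∈-column₁ c∈)))))

  xtop-∈ : ∀ {y} → (leftX P , y) ∈ P → (leftX P , xtop P) ∈ P
  xtop-∈ c∈ = column₁-∈ (proj₂ (ordinate-∈ (maxL-∈ (∈-map⁺ proj₂ (∈-column₁ c∈)))))

  rowEnd : ℤ → ℤ
  rowEnd y = maxL (map proj₁ (rowAt y P))

  ∈-rowAt : ∀ {x y} → (x , y) ∈ P → (x , y) ∈ rowAt y P
  ∈-rowAt {y = y} c∈ = ∈-filter⁺ (λ c → proj₂ c ℤ.≟ y) c∈ refl

  rowAt-∈ : ∀ {x y y'} → (x , y) ∈ rowAt y' P → (x , y') ∈ P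
  rowAt-∈ {y' = y'} c∈ with ∈-filter⁻ (λ c → proj₂ c ℤ.≟ y') {xs = P} c∈
  ... | c∈P , refl = c∈P

  ≤-rowEnd : ∀ {x y} → (x , y) ∈ P → x ≤ rowEnd y
  ≤-rowEnd c∈ = ≤-maxL (∈-map⁺ proj₁ (∈-rowAt c∈))

  rowEnd-∈ : ∀ {x y} → (x , y) ∈ P → (rowEnd y , y) ∈ P
  rowEnd-∈ c∈ = rowAt-∈ (proj₂ (abscissa-∈ (maxL-∈ (∈-map⁺ proj₁ (∈-rowAt c∈)))))

  ∈-columnS : ∀ {y} → (sX P , y) ∈ P → y ≤ xtop P → (sX P , y) ∈ columnS P
  ∈-columnS c∈ y≤ = ∈-filter⁺ (λ c → (proj₁ c ℤ.≟ sX P) ×-dec (proj₂ c ℤ.≤? xtop P)) c∈ (refl , y≤)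

  columnS-∈ : ∀ {x y} → (x , y) ∈ columnS P → (sX P , y) ∈ P × y ≤ xtop P
  columnS-∈ c∈ with ∈-filter⁻ (λ c → (proj₁ c ℤ.≟ sX P) ×-dec (proj₂ c ℤ.≤? xtop P)) {xs = P} c∈
  ... | c∈P , refl , y≤ = c∈P , y≤

RowMeets : Cells → ℤ → ℤ → Set
RowMeets Q b r = ∃[ x ] b ≤ x × (x , r) ∈ Q

-- The state of a walk that started in the quadrant x ≥ b, y ≤ r: it is in that
-- quadrant, or it last left the half-plane x ≥ b through a cell (b , v) with v ≤ r.
data Pending (Q : Cells) (b r : ℤ) : Cell → Set where
  inside : ∀ {x y} → b ≤ x → y ≤ r → Pending Q b r (x , y)
  left   : ∀ {x y v} → x < b → v ≤ r → (b , v) ∈ Q → Pending Q b r (x , y)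

pending-step : ∀ {Q b r} → ColumnsConvex Q → ∀ d {c} → c ∈ Q → move d c ∈ Q →
               Pending Q b r c → Pending Q b r (move d c) ⊎ RowMeets Q b r
pending-step {Q} {b} {r} cc d {x , y} c∈ _ (inside b≤x y≤r) with r ℤP.≤? y
... | yes r≤y = inj₂ (x , b≤x , subst (λ y → (x , y) ∈ Q) (ℤP.≤-antisym y≤r r≤y) c∈)
... | no  r≰y = inj₁ (inside-step d)
  where
  inside-step : ∀ d → Pending Q b r (move d (x , y))
  inside-step N = inside b≤x (i<j⇒i+1≤j (ℤP.≰⇒> r≰y))
  inside-step S = inside b≤x (ℤP.≤-trans (ℤP.<⇒≤ (i-1<i y)) y≤r)
  inside-step E = inside (ℤP.≤-trans b≤x (ℤP.<⇒≤ (i<i+1 x))) y≤r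
  inside-step W with b ℤP.≤? x ℤ.- 1ℤ
  ... | yes b≤x-1 = inside b≤x-1 y≤r
  ... | no  b≰x-1 =
    let x≡b = ℤP.≤-antisym (i-1<j⇒i≤j (ℤP.≰⇒> b≰x-1)) b≤x in
    left (ℤP.≰⇒> b≰x-1) y≤r (subst (λ x → (x , y) ∈ Q) x≡b c∈)
pending-step {Q} {b} {r} cc d {x , y} _ next∈ (left {v = v} x<b v≤r bv∈) = left-step d next∈
  where
  left-step : ∀ d → move d (x , y) ∈ Q → Pending Q b r (move d (x , y)) ⊎ RowMeets Q b r
  left-step N _ = inj₁ (left x<b v≤r bv∈)
  left-step S _ = inj₁ (left x<b v≤r bv∈)
  left-step W _ = inj₁ (left (ℤP.<-trans (i-1<i x) x<b) v≤r bv∈)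
  left-step E next∈ with x ℤ.+ 1ℤ ℤP.<? b
  ... | yes x+1<b = inj₁ (left x+1<b v≤r bv∈)
  ... | no  x+1≮b with y ℤP.≤? r
  ...   | yes y≤r = inj₁ (inside (ℤP.≮⇒≥ x+1≮b) y≤r)
  ...   | no  y≰r = inj₂ (b , ℤP.≤-refl , cc b v y r bv∈ by∈ v≤r (ℤP.<⇒≤ (ℤP.≰⇒> y≰r)))
    where
    by∈ : (b , y) ∈ Q
    by∈ = subst (λ x → (x , y) ∈ Q) (ℤP.≤-antisym (i<j⇒i+1≤j x<b) (ℤP.≮⇒≥ x+1≮b)) next∈

walk-meets-row : ∀ {Q b r} → ColumnsConvex Q → ∀ {c x y} ds → Walk Q c (x , y) ds →
                 Pending Q b r c → b ≤ x → r ≤ y → RowMeets Q b r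
walk-meets-row {Q} cc [] (c∈ ∷ [] , refl) (inside {x} b≤x y≤r) _ r≤y =
  x , b≤x , subst (λ y → (x , y) ∈ Q) (ℤP.≤-antisym y≤r r≤y) c∈
walk-meets-row cc [] (_ , refl) (left x<b _ _) b≤x _ = ⊥-elim (ℤP.<⇒≱ x<b b≤x)
walk-meets-row cc {c} (d ∷ ds) (c∈ ∷ cells , end) pending b≤x r≤y
  with pending-step cc d c∈ (cellsOf-head (move d c) ds cells) pending
... | inj₁ pending' = walk-meets-row cc ds (cells , end) pending' b≤x r≤y
... | inj₂ meets    = meets

-- A walk from a rightmost cell to a cell above row r right of b would cross
-- row r right of b.
row-bounds-above : ∀ {Q} → Polyomino Q → ColumnsConvex Q → ∀ {x₀ y₀ r b} →
                   (x₀ , y₀) ∈ Q → (∀ {x y} → (x , y) ∈ Q → x ≤ x₀) → y₀ ≤ r →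
                   (∀ {x} → (x , r) ∈ Q → x ≤ b) → ∀ {x y} → (x , y) ∈ Q → r ≤ y → x ≤ b
row-bounds-above (_ , walks) cc {b = b} c₀∈ rightmost y₀≤r row-r {x} c∈ r≤y with x ℤP.≤? b
... | yes x≤b = x≤b
... | no  x≰b =
  let ds , walk = walks _ _ c₀∈ c∈
      b+1≤x = ℤP.i<j⇒suc[i]≤j (ℤP.≰⇒> x≰b)
      x' , b+1≤x' , x'∈ =
        walk-meets-row cc ds walk (inside (ℤP.≤-trans b+1≤x (rightmost c∈)) y₀≤r) b+1≤x r≤y
  in ⊥-elim (ℤP.<⇒≱ (ℤP.suc[i]≤j⇒i<j b+1≤x') (row-r x'∈))

-- Descending polyominoes and their reduction Φ

module DescendingPolyomino (P : Cells) (cp : ConvexPolyomino P)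
  -- Non-centredness, the other half of Descending, follows from this.
  (right-column-below : ∀ c → c ∈ P → proj₁ c ≡ rightX P → proj₂ c < ybot P) where

  rc : RowsConvex P
  rc = proj₁ (proj₂ cp)

  cc : ColumnsConvex P
  cc = proj₂ (proj₂ cp)

  a R xt yb s t m δ ε : ℤ
  a  = leftX P
  R  = rightX P
  xt = xtop P
  yb = ybot P
  s  = sX P
  t  = tY P
  m  = minL (map proj₂ (columnS P))
  δ  = xt - yb
  ε  = t - s

  some-cell : ∃[ c ] c ∈ P
  some-cell = proj₁ (proj₁ cp)

  a-xt : (a , xt) ∈ P
  a-xt = xtop-∈ (proj₂ (leftX-∈ (proj₂ some-cell)))

  a-yb : (a , yb) ∈ P
  a-yb = ybot-∈ (proj₂ (leftX-∈ (proj₂ some-cell)))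

  s-xt : (s , xt) ∈ P
  s-xt = rowEnd-∈ a-xt

  t-yb : (t , yb) ∈ P
  t-yb = rowEnd-∈ a-yb

  s-m : (s , m) ∈ P × m ≤ xt
  s-m = columnS-∈ (proj₂ (ordinate-∈ (minL-∈ (∈-map⁺ proj₂ (∈-columnS s-xt ℤP.≤-refl)))))

  m-≤ : ∀ {y} → (s , y) ∈ P → y ≤ xt → m ≤ y
  m-≤ c∈ y≤xt = minL-≤ (∈-map⁺ proj₂ (∈-columnS c∈ y≤xt))

  yb≤xt : yb ≤ xt
  yb≤xt = ybot-≤ a-xt

  0≤δ : 0ℤ ≤ δ
  0≤δ = ℤP.i≤j⇒0≤j-i yb≤xt

  R-below-yb : ∃[ y ] (R , y) ∈ P × y < yb
  R-below-yb = let y , R∈ = rightX-∈ (proj₂ some-cell) in y , R∈ , right-column-below _ R∈ refl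

  above-yb-≤-t : ∀ {x y} → (x , y) ∈ P → yb ≤ y → x ≤ t
  above-yb-≤-t = let _ , R∈ , y<yb = R-below-yb in
    row-bounds-above (proj₁ cp) cc R∈ ≤-rightX (ℤP.<⇒≤ y<yb) ≤-rowEnd

  above-xt-≤-s : ∀ {x y} → (x , y) ∈ P → xt ≤ y → x ≤ s
  above-xt-≤-s = let _ , R∈ , y<yb = R-below-yb in
    row-bounds-above (proj₁ cp) cc R∈ ≤-rightX (ℤP.<⇒≤ (ℤP.<-≤-trans y<yb yb≤xt)) ≤-rowEnd

  s≤t : s ≤ t
  s≤t = above-yb-≤-t s-xt yb≤xt

  0≤ε : 0ℤ ≤ ε
  0≤ε = ℤP.i≤j⇒0≤j-i s≤t

  right-of-t-below-yb : ∀ {x y} → (x , y) ∈ P → t < x → y < yb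
  right-of-t-below-yb c∈ t<x with yb ℤP.≤? _
  ... | yes yb≤y = ⊥-elim (ℤP.<⇒≱ t<x (above-yb-≤-t c∈ yb≤y))
  ... | no  yb≰y = ℤP.≰⇒> yb≰y

  row-yb-∈ : ∀ {x} → a ≤ x → x ≤ t → (x , yb) ∈ P
  row-yb-∈ a≤x x≤t = rc a t _ yb a-yb t-yb a≤x x≤t

  block-∈ : ∀ {x y} → a ≤ x → x ≤ s → yb ≤ y → y ≤ xt → (x , y) ∈ P
  block-∈ {x} a≤x x≤s =
    cc x yb xt _ (row-yb-∈ a≤x (ℤP.≤-trans x≤s s≤t)) (rc a s x xt a-xt s-xt a≤x x≤s)

  column-s-∈ : ∀ {y} → m ≤ y → y ≤ xt → (s , y) ∈ P
  column-s-∈ = cc s m xt _ (proj₁ s-m) s-xt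

  θAboveS : Set
  θAboveS = ∀ c → c ∈ θ P → m ≤ proj₂ c

  ∈-θ : ∀ {x y} → (x , y) ∈ P → t < x → (x , y) ∈ θ P
  ∈-θ c∈ t<x = ∈-filter⁺ (λ c → t ℤP.<? proj₁ c) c∈ t<x

  θAboveS⇒column-s-∈ : θAboveS → ∀ {x y} → (x , y) ∈ P → t < x → (s , y) ∈ P
  θAboveS⇒column-s-∈ above c∈ t<x =
    column-s-∈ (above _ (∈-θ c∈ t<x)) (ℤP.≤-trans (ℤP.<⇒≤ (right-of-t-below-yb c∈ t<x)) yb≤xt)

  linked⇒θAboveS : AllZLinked P → θAboveS
  linked⇒θAboveS linked (x , y) c∈θ with ∈-filter⁻ (λ c → t ℤP.<? proj₁ c) {xs = P} c∈θ
  ... | c∈ , t<x with m ℤP.≤? y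
  ...   | yes m≤y = m≤y
  ...   | no  m≰y with linked a-xt c∈
  ...     | inj₁ (u , u-xt , u-y) =
    let y<m = ℤP.≰⇒> m≰y
        s-y = rc u x s y u-y c∈ (≤-rowEnd u-xt) (ℤP.≤-trans s≤t (ℤP.<⇒≤ t<x))
    in ⊥-elim (ℤP.<⇒≱ y<m (m-≤ s-y (ℤP.≤-trans (ℤP.<⇒≤ y<m) (proj₂ s-m))))
  ...     | inj₂ (v , a-v , x-v) = ⊥-elim (ℤP.<⇒≱ t<x (above-yb-≤-t x-v (ybot-≤ a-v)))

  lowerω shiftθ : Cell → Cell
  lowerω = translate 0ℤ (- δ)
  shiftθ = translate (- ε) 0ℤ

  data InΦ : Cell → Set where
    ξ-cell : ∀ {x y} → y ≤ yb → x ≤ s → (x , y) ∈ P → InΦ (x , y)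
    ω-cell : ∀ {x y} → yb < y → x ≤ s → (x , y + δ) ∈ P → InΦ (x , y)
    θ-cell : ∀ {x y} → y < yb → s < x → (x + ε , y) ∈ P → InΦ (x , y)

  ξ-∈Φ : ∀ {x y} → (x , y) ∈ P → y ≤ yb → x ≤ s → (x , y) ∈ Φ P
  ξ-∈Φ c∈ y≤yb x≤s =
    ∈-++⁺ˡ (∈-filter⁺ (λ c → (proj₂ c ℤP.≤? yb) ×-dec (proj₁ c ℤP.≤? s)) c∈ (y≤yb , x≤s))

  ω-∈Φ : ∀ {x y} → yb < y → (x , y + δ) ∈ P → (x , y) ∈ Φ P
  ω-∈Φ {x} {y} yb<y c∈ = ∈-++⁺ʳ (ξ P) (∈-++⁺ˡ (subst (_∈ map lowerω (ω P)) lowered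
    (∈-map⁺ lowerω (∈-filter⁺ (λ c → xt ℤP.<? proj₂ c) c∈ (i<x⇒j<x+[j-i] yb<y)))))
    where
    lowered : lowerω (x , y + δ) ≡ (x , y)
    lowered = cong₂ _,_ (ℤP.+-identityʳ x) (i+j-j≡i y δ)

  θ-∈Φ : ∀ {x y} → s < x → (x + ε , y) ∈ P → (x , y) ∈ Φ P
  θ-∈Φ {x} {y} s<x c∈ = ∈-++⁺ʳ (ξ P) (∈-++⁺ʳ (map lowerω (ω P)) (subst (_∈ map shiftθ (θ P)) shifted
    (∈-map⁺ shiftθ (∈-θ c∈ (i<x⇒j<x+[j-i] s<x)))))
    where
    shifted : shiftθ (x + ε , y) ≡ (x , y)
    shifted = cong₂ _,_ (i+j-j≡i x ε) (ℤP.+-identityʳ y)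

  Φ-∈ : ∀ {c} → c ∈ Φ P → InΦ c
  Φ-∈ c∈ with ∈-++⁻ (ξ P) c∈
  ... | inj₁ c∈ξ with ∈-filter⁻ (λ c → (proj₂ c ℤP.≤? yb) ×-dec (proj₁ c ℤP.≤? s)) {xs = P} c∈ξ
  ...   | c∈P , y≤yb , x≤s = ξ-cell y≤yb x≤s c∈P
  Φ-∈ c∈ | inj₂ c∈ωθ with ∈-++⁻ (map lowerω (ω P)) c∈ωθ
  ... | inj₁ c∈ω with ∈-map⁻ lowerω c∈ω
  ...   | (x , y) , c'∈ω , refl with ∈-filter⁻ (λ c → xt ℤP.<? proj₂ c) {xs = P} c'∈ω
  ...     | c'∈ , xt<y = subst InΦ (cong (_, y - δ) (sym (ℤP.+-identityʳ x)))
    (ω-cell (j<x⇒i<x-[j-i] xt<y) (above-xt-≤-s c'∈ (ℤP.<⇒≤ xt<y))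
            (subst (λ y → (x , y) ∈ P) (sym (i-j+j≡i y δ)) c'∈))
  Φ-∈ c∈ | inj₂ c∈ωθ | inj₂ c∈θ with ∈-map⁻ shiftθ c∈θ
  ... | (x , y) , c'∈θ , refl with ∈-filter⁻ (λ c → t ℤP.<? proj₁ c) {xs = P} c'∈θ
  ...   | c'∈ , t<x = subst InΦ (cong (x - ε ,_) (sym (ℤP.+-identityʳ y)))
    (θ-cell (right-of-t-below-yb c'∈ t<x) (j<x⇒i<x-[j-i] t<x)
            (subst (λ x → (x , y) ∈ P) (sym (i-j+j≡i x ε)) c'∈))

  Φ-lower-left : ∀ {x y} → (x , y) ∈ Φ P → x ≤ s → y ≤ yb → (x , y) ∈ P
  Φ-lower-left c∈ x≤s y≤yb with Φ-∈ c∈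
  ... | ξ-cell _ _ c∈P  = c∈P
  ... | ω-cell yb<y _ _ = ⊥-elim (ℤP.<⇒≱ yb<y y≤yb)
  ... | θ-cell _ s<x _  = ⊥-elim (ℤP.<⇒≱ s<x x≤s)

  Φ-upper : ∀ {x y} → (x , y) ∈ Φ P → yb < y → x ≤ s × (x , y + δ) ∈ P
  Φ-upper c∈ yb<y with Φ-∈ c∈
  ... | ξ-cell y≤yb _ _ = ⊥-elim (ℤP.<⇒≱ yb<y y≤yb)
  ... | ω-cell _ x≤s c∈P = x≤s , c∈P
  ... | θ-cell y<yb _ _ = ⊥-elim (ℤP.<-asym y<yb yb<y)

  Φ-right : ∀ {x y} → (x , y) ∈ Φ P → s < x → y < yb × (x + ε , y) ∈ P
  Φ-right c∈ s<x with Φ-∈ c∈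
  ... | ξ-cell _ x≤s _ = ⊥-elim (ℤP.<⇒≱ s<x x≤s)
  ... | ω-cell _ x≤s _ = ⊥-elim (ℤP.<⇒≱ s<x x≤s)
  ... | θ-cell y<yb _ c∈P = y<yb , c∈P

  Φ-column-shadow : ∀ {x y} → (x , y) ∈ Φ P → x ≤ s → ∃[ y' ] y ≤ y' × y' ≤ y + δ × (x , y') ∈ P
  Φ-column-shadow c∈ x≤s with Φ-∈ c∈
  ... | ξ-cell _ _ c∈P = _ , ℤP.≤-refl , 0≤j⇒i≤i+j 0≤δ , c∈P
  ... | ω-cell _ _ c∈P = _ , 0≤j⇒i≤i+j 0≤δ , ℤP.≤-refl , c∈P
  ... | θ-cell _ s<x _ = ⊥-elim (ℤP.<⇒≱ s<x x≤s)

  Φ-row-shadow : ∀ {x y} → (x , y) ∈ Φ P → y ≤ yb → ∃[ x' ] x ≤ x' × x' ≤ x + ε × (x' , y) ∈ P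
  Φ-row-shadow c∈ y≤yb with Φ-∈ c∈
  ... | ξ-cell _ _ c∈P  = _ , ℤP.≤-refl , 0≤j⇒i≤i+j 0≤ε , c∈P
  ... | ω-cell yb<y _ _ = ⊥-elim (ℤP.<⇒≱ yb<y y≤yb)
  ... | θ-cell _ _ c∈P  = _ , 0≤j⇒i≤i+j 0≤ε , ℤP.≤-refl , c∈P

  Φ-nonempty : ∃[ c ] c ∈ Φ P
  Φ-nonempty = (a , yb) , ξ-∈Φ a-yb ℤP.≤-refl (leftX-≤ s-xt)

  Φ-rowsConvex : RowsConvex (Φ P)
  Φ-rowsConvex x₁ x₂ x y c₁ c₂ x₁≤x x≤x₂ with yb ℤP.<? y
  ... | yes yb<y =
    ω-∈Φ yb<y (rc x₁ x₂ x (y + δ) (proj₂ (Φ-upper c₁ yb<y)) (proj₂ (Φ-upper c₂ yb<y)) x₁≤x x≤x₂)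
  ... | no yb≮y with ℤP.≮⇒≥ yb≮y | x ℤP.≤? s
  ...   | y≤yb | yes x≤s =
    let x₂' , x₂≤x₂' , _ , c₂' = Φ-row-shadow c₂ y≤yb
        c₁' = Φ-lower-left c₁ (ℤP.≤-trans x₁≤x x≤s) y≤yb
    in ξ-∈Φ (rc x₁ x₂' x y c₁' c₂' x₁≤x (ℤP.≤-trans x≤x₂ x₂≤x₂')) y≤yb x≤s
  ...   | y≤yb | no x≰s =
    let s<x = ℤP.≰⇒> x≰s
        x₁' , _ , x₁'≤x₁+ε , c₁' = Φ-row-shadow c₁ y≤yb
        c₂' = proj₂ (Φ-right c₂ (ℤP.<-≤-trans s<x x≤x₂))
    in θ-∈Φ s<x (rc x₁' (x₂ + ε) (x + ε) y c₁' c₂'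
                    (ℤP.≤-trans x₁'≤x₁+ε (ℤP.+-monoˡ-≤ ε x₁≤x)) (ℤP.+-monoˡ-≤ ε x≤x₂))

  Φ-columnsConvex : ColumnsConvex (Φ P)
  Φ-columnsConvex x y₁ y₂ y c₁ c₂ y₁≤y y≤y₂ with s ℤP.<? x
  ... | yes s<x =
    θ-∈Φ s<x (cc (x + ε) y₁ y₂ y (proj₂ (Φ-right c₁ s<x)) (proj₂ (Φ-right c₂ s<x)) y₁≤y y≤y₂)
  ... | no s≮x with ℤP.≮⇒≥ s≮x | yb ℤP.<? y
  ...   | x≤s | yes yb<y =
    let y₁' , _ , y₁'≤y₁+δ , c₁' = Φ-column-shadow c₁ x≤s
        c₂' = proj₂ (Φ-upper c₂ (ℤP.<-≤-trans yb<y y≤y₂))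
    in ω-∈Φ yb<y (cc x y₁' (y₂ + δ) (y + δ) c₁' c₂'
                    (ℤP.≤-trans y₁'≤y₁+δ (ℤP.+-monoˡ-≤ δ y₁≤y)) (ℤP.+-monoˡ-≤ δ y≤y₂))
  ...   | x≤s | no yb≮y =
    let y≤yb = ℤP.≮⇒≥ yb≮y
        y₂' , y₂≤y₂' , _ , c₂' = Φ-column-shadow c₂ x≤s
        c₁' = Φ-lower-left c₁ x≤s (ℤP.≤-trans y₁≤y y≤yb)
    in ξ-∈Φ (cc x y₁ y₂' y c₁' c₂' y₁≤y (ℤP.≤-trans y≤y₂ y₂≤y₂')) y≤yb x≤s

  Φ-row-yb-∈ : ∀ {x y} → (x , y) ∈ Φ P → x ≤ s → (x , yb) ∈ Φ P
  Φ-row-yb-∈ c∈ x≤s = let _ , _ , _ , c∈P = Φ-column-shadow c∈ x≤s in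
    ξ-∈Φ (row-yb-∈ (leftX-≤ c∈P) (ℤP.≤-trans x≤s s≤t)) ℤP.≤-refl x≤s

  Φ-column-s-∈ : θAboveS → ∀ {x y} → (x , y) ∈ Φ P → s < x → (s , y) ∈ Φ P
  Φ-column-s-∈ above c∈ s<x = let y<yb , c∈P = Φ-right c∈ s<x in
    ξ-∈Φ (θAboveS⇒column-s-∈ above c∈P (i<x⇒j<x+[j-i] s<x)) (ℤP.<⇒≤ y<yb) ℤP.≤-refl

  Φ-left-right-row-linked : ∀ {x₁ y₁ x₂ y₂ v} → (x₁ , v) ∈ P → x₁ ≤ s → (x₂ + ε , v) ∈ P → s < x₂ →
                   ZLinked (Φ P) (x₁ , y₁) (x₂ , y₂)
  Φ-left-right-row-linked c₁ x₁≤s c₂ s<x₂ =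
    inj₂ (_ , ξ-∈Φ c₁ (ℤP.<⇒≤ (right-of-t-below-yb c₂ (i<x⇒j<x+[j-i] s<x₂))) x₁≤s , θ-∈Φ s<x₂ c₂)

  Φ-left-right-linked : AllZLinked P → ∀ {x₁ y₁ x₂ y₂} → (x₁ , y₁) ∈ Φ P → x₁ ≤ s →
                      (x₂ , y₂) ∈ Φ P → s < x₂ → ZLinked (Φ P) (x₁ , y₁) (x₂ , y₂)
  Φ-left-right-linked linked {x₁} {y₁} c₁ x₁≤s c₂ s<x₂ with Φ-right c₂ s<x₂ | yb ℤP.<? y₁
  ... | y₂<yb , c₂' | yes yb<y₁ with linked (proj₂ (Φ-upper c₁ yb<y₁)) c₂'
  ...   | inj₂ (v , p , q) = Φ-left-right-row-linked p x₁≤s q s<x₂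
  ...   | inj₁ (u , p , q) =
    inj₁ (u , ω-∈Φ yb<y₁ p , ξ-∈Φ q (ℤP.<⇒≤ y₂<yb) (above-xt-≤-s p (ℤP.<⇒≤ (i<x⇒j<x+[j-i] yb<y₁))))
  Φ-left-right-linked linked {x₁} {y₁} c₁ x₁≤s c₂ s<x₂ | y₂<yb , c₂' | no yb≮y₁
    with ℤP.≮⇒≥ yb≮y₁ | linked (Φ-lower-left c₁ x₁≤s (ℤP.≮⇒≥ yb≮y₁)) c₂'
  ... | _    | inj₂ (v , p , q) = Φ-left-right-row-linked p x₁≤s q s<x₂
  ... | y₁≤yb | inj₁ (u , p , q) with u ℤP.≤? s
  ...   | yes u≤s = inj₁ (u , ξ-∈Φ p y₁≤yb u≤s , ξ-∈Φ q (ℤP.<⇒≤ y₂<yb) u≤s)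
  ...   | no  u≰s =
    let s-y₁ = rc x₁ u s y₁ (Φ-lower-left c₁ x₁≤s y₁≤yb) p x₁≤s (ℤP.<⇒≤ (ℤP.≰⇒> u≰s))
    in inj₁ (s , ξ-∈Φ s-y₁ y₁≤yb ℤP.≤-refl , Φ-column-s-∈ (linked⇒θAboveS linked) c₂ s<x₂)

  Φ-linked : AllZLinked P → AllZLinked (Φ P)
  Φ-linked linked {x₁ , _} {x₂ , _} c₁ c₂ with x₁ ℤP.≤? s | x₂ ℤP.≤? s
  ... | yes x₁≤s | yes x₂≤s = inj₂ (yb , Φ-row-yb-∈ c₁ x₁≤s , Φ-row-yb-∈ c₂ x₂≤s)
  ... | yes x₁≤s | no  x₂≰s = Φ-left-right-linked linked c₁ x₁≤s c₂ (ℤP.≰⇒> x₂≰s)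
  ... | no  x₁≰s | yes x₂≤s = zlinked-sym _ _ (Φ-left-right-linked linked c₂ x₂≤s c₁ (ℤP.≰⇒> x₁≰s))
  ... | no  x₁≰s | no  x₂≰s =
    let above = linked⇒θAboveS linked in
    inj₁ (s , Φ-column-s-∈ above c₁ (ℤP.≰⇒> x₁≰s) , Φ-column-s-∈ above c₂ (ℤP.≰⇒> x₂≰s))

  row-linked-from-Φ : ∀ {w x₂ y₁ y₂ v} → (w , v) ∈ Φ P → s < w → (x₂ , v) ∈ Φ P → x₂ ≤ s →
                   ZLinked P (w + ε , y₁) (x₂ , y₂)
  row-linked-from-Φ c₁ s<w c₂ x₂≤s = let v<yb , c₁' = Φ-right c₁ s<w in
    inj₂ (_ , c₁' , Φ-lower-left c₂ x₂≤s (ℤP.<⇒≤ v<yb))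

  θ-linked-left-of-s : θAboveS → AllZLinked (Φ P) → ∀ {w y₁ x₂ y₂} → s < w → (w + ε , y₁) ∈ P →
                        (x₂ , y₂) ∈ P → x₂ ≤ s → ZLinked P (w + ε , y₁) (x₂ , y₂)
  θ-linked-left-of-s above linkedΦ {w} {y₁} {x₂} {y₂} s<w c₁ c₂ x₂≤s
    with right-of-t-below-yb c₁ (i<x⇒j<x+[j-i] s<w) | y₂ ℤP.≤? yb
  ... | y₁<yb | yes y₂≤yb with linkedΦ (θ-∈Φ s<w c₁) (ξ-∈Φ c₂ y₂≤yb x₂≤s)
  ...   | inj₂ (v , p , q) = row-linked-from-Φ p s<w q x₂≤s
  ...   | inj₁ (u , p , q) with u ℤP.≤? s
  ...     | yes u≤s = inj₁ (u , Φ-lower-left p u≤s (ℤP.<⇒≤ y₁<yb) , Φ-lower-left q u≤s y₂≤yb)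
  ...     | no  u≰s = inj₁ (u + ε , proj₂ (Φ-right p (ℤP.≰⇒> u≰s)) , proj₂ (Φ-right q (ℤP.≰⇒> u≰s)))
  θ-linked-left-of-s above linkedΦ {w} {y₁} {x₂} {y₂} s<w c₁ c₂ x₂≤s | y₁<yb | no y₂≰yb
    with y₂ ℤP.≤? xt
  ... | yes y₂≤xt = inj₁ (s , θAboveS⇒column-s-∈ above c₁ (i<x⇒j<x+[j-i] s<w) ,
                          block-∈ (leftX-≤ s-xt) ℤP.≤-refl (ℤP.<⇒≤ (ℤP.≰⇒> y₂≰yb)) y₂≤xt)
  ... | no  y₂≰xt with j<x⇒i<x-[j-i] (ℤP.≰⇒> y₂≰xt)
  ...   | yb<y₂-δ with linkedΦ (θ-∈Φ s<w c₁)
                              (ω-∈Φ yb<y₂-δ (subst (λ y → (x₂ , y) ∈ P) (sym (i-j+j≡i y₂ δ)) c₂))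
  ...     | inj₂ (v , p , q) = row-linked-from-Φ p s<w q x₂≤s
  ...     | inj₁ (u , p , q) = let u≤s , q' = Φ-upper q yb<y₂-δ in
    inj₁ (u , Φ-lower-left p u≤s (ℤP.<⇒≤ y₁<yb) , subst (λ y → (u , y) ∈ P) (i-j+j≡i y₂ δ) q')

  θ-linked-outside-θ : θAboveS → AllZLinked (Φ P) → ∀ {x₁ y₁ x₂ y₂} → (x₁ , y₁) ∈ P → t < x₁ →
                      (x₂ , y₂) ∈ P → x₂ ≤ t → ZLinked P (x₁ , y₁) (x₂ , y₂)
  θ-linked-outside-θ above linkedΦ {x₁} {y₁} {x₂} {y₂} c₁ t<x₁ c₂ x₂≤t with s ℤP.≤? x₂
  ... | yes s≤x₂ =
    let s-y₁ = θAboveS⇒column-s-∈ above c₁ t<x₁ in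
    inj₁ (x₂ , rc s x₁ x₂ y₁ s-y₁ c₁ s≤x₂ (ℤP.≤-trans x₂≤t (ℤP.<⇒≤ t<x₁)) , c₂)
  ... | no  s≰x₂ = subst (λ x → ZLinked P (x , y₁) (x₂ , y₂)) (i-j+j≡i x₁ ε)
    (θ-linked-left-of-s above linkedΦ (j<x⇒i<x-[j-i] t<x₁)
      (subst (λ x → (x , y₁) ∈ P) (sym (i-j+j≡i x₁ ε)) c₁) c₂ (ℤP.<⇒≤ (ℤP.≰⇒> s≰x₂)))

  linked-from-Φ : θAboveS → AllZLinked (Φ P) → AllZLinked P
  linked-from-Φ above linkedΦ {x₁ , _} {x₂ , _} c₁ c₂ with x₁ ℤP.≤? t | x₂ ℤP.≤? t
  ... | yes x₁≤t | yes x₂≤t = inj₂ (yb , row-yb-∈ (leftX-≤ c₁) x₁≤t , row-yb-∈ (leftX-≤ c₂) x₂≤t)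
  ... | no  x₁≰t | yes x₂≤t = θ-linked-outside-θ above linkedΦ c₁ (ℤP.≰⇒> x₁≰t) c₂ x₂≤t
  ... | yes x₁≤t | no  x₂≰t =
    zlinked-sym _ _ (θ-linked-outside-θ above linkedΦ c₂ (ℤP.≰⇒> x₂≰t) c₁ x₁≤t)
  ... | no  x₁≰t | no  x₂≰t =
    inj₁ (s , θAboveS⇒column-s-∈ above c₁ (ℤP.≰⇒> x₁≰t) , θAboveS⇒column-s-∈ above c₂ (ℤP.≰⇒> x₂≰t))

lemma3 : (P : Cells) → ConvexPolyomino P → Descending P →
    (ZConvex P ⇔
      ((∀ c → c ∈ θ P → minL (map proj₂ (columnS P)) ≤ proj₂ c)
       × ZConvex (Φ P)))
lemma3 P cp desc = mk⇔
  (λ zP → let linked = ZConvex⇒linked zP in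
    linked⇒θAboveS linked ,
    linked⇒ZConvex Φ-nonempty Φ-rowsConvex Φ-columnsConvex (Φ-linked linked))
  (λ (above , zΦ) → linked⇒ZConvex some-cell rc cc (linked-from-Φ above (ZConvex⇒linked zΦ)))
  where open DescendingPolyomino P cp (proj₂ desc)
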